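{- Let $a$ be a positive integer and let $\mathcal{E}$ be the equation $ax+ay=z$. Then for every positive integer $n$, $$M_{\mathcal{E}}(n) \leq \left\lfloor\frac{n^2}{2a^4}+\frac{n}{2a^2}\right\rfloor.$$ Moreover, this bound is not tight in general, i.e. there are values for which the inequality is strict.
   Context: For a positive integer $n$, $[n]=\{1,\dots,n\}$. A solution of a 3-variable equation in $[n]$ is an ordered triple $(x,y,z)\in[n]^3$ satisfying it; $(x,y,z)$ and $(y,x,z)$ with $x\neq y$ are counted as different solutions. Given a $k$-coloring $\chi$ of $[n]$, $\mu_\chi(\mathcal{E},n,k)$ is the number of solutions with $\chi(x)=\chi(y)=\chi(z)$ (monochromatic solutions). $M_{\mathcal{E}}(n,k)=\min_\chi \mu_\chi(\mathcal{E},n,k)$ over all $k$-colorings $\chi$ of $[n]$, and $M_{\mathcal{E}}(n)=M_{\mathcal{E}}(n,2)$. -}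

module Defs where

open import Data.Nat using (ℕ; zero; suc; _+_; _*_; _^_; _⊓_; _≡ᵇ_)
open import Data.Nat.DivMod using (_/_)
open import Data.Bool using (Bool; true; false; _∧_; if_then_else_)
open import Data.Bool.Properties using () renaming (_≟_ to _≟ᵇ_)
open import Data.Fin using (Fin; toℕ)
open import Data.List using (List; []; _∷_; map; concatMap; foldr; allFin)
open import Data.Nat.ListAction using (sum)
open import Data.Vec using (Vec; []; _∷_; lookup; replicate)
open import Relation.Nullary.Decidable using (⌊_⌋)

-- A 2-colouring of [n] = {1,…,n}: entry i (i : Fin n) is the colour of the integer i+1.
Coloring : ℕ → Set
Coloring n = Vec Bool n

elt : ∀ {n} → Fin n → ℕ
elt i = suc (toℕ i)

allColorings : (n : ℕ) → List (Coloring n)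
allColorings zero = [] ∷ []
allColorings (suc n) = concatMap (λ c → (false ∷ c) ∷ (true ∷ c) ∷ []) (allColorings n)

_==_ : Bool → Bool → Bool
b == c = ⌊ b ≟ᵇ c ⌋

monoSol : (a : ℕ) {n : ℕ} → Coloring n → Fin n → Fin n → Fin n → Bool
monoSol a χ x y z =
  ((a * elt x + a * elt y) ≡ᵇ elt z) ∧ (lookup χ x == lookup χ y) ∧ (lookup χ y == lookup χ z)

count : Bool → ℕ
count b = if b then 1 else 0

μ : (a n : ℕ) → Coloring n → ℕ
μ a n χ = sum (map (λ x → sum (map (λ y → sum (map (λ z → count (monoSol a χ x y z))
            (allFin n))) (allFin n))) (allFin n))

-- M_E(n) = M_E(n,2): minimum of μ over all 2-colourings of [n].
-- (The all-`false` colouring occurs in the list, so it is a valid seed for the minimum.)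
M : (a n : ℕ) → ℕ
M a n = foldr _⊓_ (μ a n (replicate n false)) (map (μ a n) (allColorings n))

-- ⌊ n²/(2a⁴) + n/(2a²) ⌋ = ⌊ (n² + a² n) / (2 a⁴) ⌋ ; only meaningful for a ≥ 1
-- (the value at a = 0 is an unused placeholder).
bound : (a n : ℕ) → ℕ
bound zero n = 0
bound (suc k) n = (n * n + suc k * suc k * n) / (2 * suc k ^ 4)

-- Colour z ∈ [n] red when 2az ≤ n and blue otherwise. A red solution of ax + ay = z has
-- 2a²x ≤ 2az ≤ n, so x and y lie in [s] with s = ⌊n/(2a²)⌋, and z is determined by x and y.
-- A blue solution would have 2z = 2ax + 2ay > 2n, which is impossible. So this colouring has at
-- most s² ≤ n²/(4a⁴) monochromatic solutions. For strictness, M(1) = 0 < 1 at a = 1.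
module Submission where

open import Defs
open import Data.Nat using (ℕ; zero; suc; _+_; _*_; _^_; _≤_; _<_; _⊓_; _≡ᵇ_; _≤ᵇ_; z≤n; s≤s; NonZero)
open import Data.Product using (_×_; _,_; ∃-syntax)
open import Data.Nat.Properties
open import Data.Nat.DivMod using (_/_; m*n/n≡m; m/n*n≤m; /-monoˡ-≤)
open import Data.Nat.ListAction using (sum)
open import Data.Nat.Tactic.RingSolver using (solve-∀)
open import Data.Bool using (Bool; true; false; T; _∧_)
open import Data.Bool.Properties using (T-∧)
open import Data.Empty using (⊥; ⊥-elim)
open import Data.Fin using (Fin)
open import Data.Fin.Properties using (toℕ<n)
open import Data.List using (List; []; _∷_; map; foldr; tabulate; allFin)
open import Data.List.Properties using (map-tabulate)
open import Data.List.Membership.Propositional using (_∈_)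
open import Data.List.Membership.Propositional.Properties using (∈-map⁺; ∈-concatMap⁺)
open import Data.List.Relation.Unary.Any as Any using (here; there)
open import Data.Vec as Vec using ([]; _∷_; lookup)
open import Data.Vec.Properties using (lookup∘tabulate)
open import Function using (_∘_; id; Equivalence)
open import Relation.Nullary using (¬_)
open import Relation.Nullary.Decidable using (toWitness)
open import Relation.Binary.PropositionalEquality
open ≤-Reasoning

count-∧ : ∀ b c → count (b ∧ c) ≡ count b * count c
count-∧ false c     = refl
count-∧ true  false = refl
count-∧ true  true  = refl

count-mono : ∀ {b c} → (T b → T c) → count b ≤ count c
count-mono {false}        _   = z≤n
count-mono {true} {true}  _   = s≤s z≤n
count-mono {true} {false} b⇒c = ⊥-elim (b⇒c _)

module _ {A : Set} where

  sum-map-mono : ∀ {f g : A → ℕ} (xs : List A) → (∀ x → f x ≤ g x) → sum (map f xs) ≤ sum (map g xs)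
  sum-map-mono []       f≤g = z≤n
  sum-map-mono (x ∷ xs) f≤g = +-mono-≤ (f≤g x) (sum-map-mono xs f≤g)

  sum-map-*ˡ : ∀ c (f : A → ℕ) xs → sum (map (λ x → c * f x) xs) ≡ c * sum (map f xs)
  sum-map-*ˡ c f []       = sym (*-zeroʳ c)
  sum-map-*ˡ c f (x ∷ xs) = begin-equality
    c * f x + sum (map (λ x → c * f x) xs) ≡⟨ cong (c * f x +_) (sum-map-*ˡ c f xs) ⟩
    c * f x + c * sum (map f xs)           ≡⟨ *-distribˡ-+ c (f x) _ ⟨
    c * (f x + sum (map f xs))             ∎

sum-allFin : ∀ {n} (f : Fin n → ℕ) → sum (map f (allFin n)) ≡ sum (tabulate f)
sum-allFin f = cong sum (map-tabulate id f)

sum-tabulate-0 : ∀ n → sum (tabulate {n = n} (λ _ → 0)) ≡ 0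
sum-tabulate-0 zero    = refl
sum-tabulate-0 (suc n) = sum-tabulate-0 n

-- The recursions below rely on suc m ≡ᵇ suc n and suc m ≤ᵇ suc n reducing to m ≡ᵇ n and m ≤ᵇ n.
sum-count-≡ᵇ-elt≤1 : ∀ n v → sum (tabulate {n = n} (λ i → count (v ≡ᵇ elt i))) ≤ 1
sum-count-≡ᵇ-elt≤1 zero    v             = z≤n
sum-count-≡ᵇ-elt≤1 (suc n) zero          = sum-count-≡ᵇ-elt≤1 n zero
sum-count-≡ᵇ-elt≤1 (suc n) (suc zero)    = ≤-reflexive (cong suc (sum-tabulate-0 n))
sum-count-≡ᵇ-elt≤1 (suc n) (suc (suc v)) = sum-count-≡ᵇ-elt≤1 n (suc v)

sum-count-elt-≤ᵇ≤ : ∀ n s → sum (tabulate {n = n} (λ i → count (elt i ≤ᵇ s))) ≤ s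
sum-count-elt-≤ᵇ≤ zero    s       = z≤n
sum-count-elt-≤ᵇ≤ (suc n) zero    = sum-count-elt-≤ᵇ≤ n zero
sum-count-elt-≤ᵇ≤ (suc n) (suc s) = s≤s (sum-count-elt-≤ᵇ≤ n s)

∈-allColorings : ∀ {n} (χ : Coloring n) → χ ∈ allColorings n
∈-allColorings []      = here refl
∈-allColorings (b ∷ χ) =
  ∈-concatMap⁺ (λ c → (false ∷ c) ∷ (true ∷ c) ∷ []) (Any.map (λ { refl → extension b }) (∈-allColorings χ))
  where
  extension : ∀ b → (b ∷ χ) ∈ ((false ∷ χ) ∷ (true ∷ χ) ∷ [])
  extension false = here refl
  extension true  = there (here refl)

foldr-⊓-≤ : ∀ {e x} {xs : List ℕ} → x ∈ xs → foldr _⊓_ e xs ≤ x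
foldr-⊓-≤ (here refl)            = m⊓n≤m _ _
foldr-⊓-≤ {xs = y ∷ _} (there p) = ≤-trans (m⊓n≤n y _) (foldr-⊓-≤ p)

M≤μ : ∀ a n (χ : Coloring n) → M a n ≤ μ a n χ
M≤μ a n χ = foldr-⊓-≤ (∈-map⁺ (μ a n) (∈-allColorings χ))

m*n≤o⇒m≤o/n : ∀ m n {o} .{{_ : NonZero n}} → m * n ≤ o → m ≤ o / n
m*n≤o⇒m≤o/n m n mn≤o = subst (_≤ _) (m*n/n≡m m n) (/-monoˡ-≤ n mn≤o)

module SplitColoring (k n : ℕ) where

  a : ℕ
  a = suc k

  s : ℕ
  s = n / (2 * a * a)

  red : Fin n → Bool
  red z = 2 * a * elt z ≤ᵇ n

  χ : Coloring n
  χ = Vec.tabulate red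

  small : Fin n → Bool
  small x = elt x ≤ᵇ s

  red-bounds-summand : ∀ {t} z → a * t ≤ elt z → T (red z) → t ≤ s
  red-bounds-summand {t} z at≤z rz = m*n≤o⇒m≤o/n t (2 * a * a) (begin
    t * (2 * a * a)   ≡⟨ trans (*-comm t (2 * a * a)) (*-assoc (2 * a) a t) ⟩
    2 * a * (a * t)   ≤⟨ *-monoʳ-≤ (2 * a) at≤z ⟩
    2 * a * elt z     ≤⟨ ≤ᵇ⇒≤ _ _ rz ⟩
    n                 ∎)

  blue-summands-impossible : (x y z : Fin n) → a * elt x + a * elt y ≡ elt z → ¬ T (red x) → ¬ T (red y) → ⊥
  blue-summands-impossible x y z sol bx by = <-irrefl refl (begin-strict
    2 * elt z                         ≤⟨ *-monoʳ-≤ 2 (toℕ<n z) ⟩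
    2 * n                             ≡⟨ cong (n +_) (+-identityʳ n) ⟩
    n + n                             <⟨ +-mono-< (above x bx) (above y by) ⟩
    2 * a * elt x + 2 * a * elt y     ≡⟨ cong₂ _+_ (*-assoc 2 a (elt x)) (*-assoc 2 a (elt y)) ⟩
    2 * (a * elt x) + 2 * (a * elt y) ≡⟨ *-distribˡ-+ 2 (a * elt x) (a * elt y) ⟨
    2 * (a * elt x + a * elt y)       ≡⟨ cong (2 *_) sol ⟩
    2 * elt z                         ∎)
    where
    above : ∀ w → ¬ T (red w) → n < 2 * a * elt w
    above w bw = ≰⇒> (bw ∘ ≤⇒≤ᵇ)

  monochromatic-small : ∀ x y z → a * elt x + a * elt y ≡ elt z →
                        red x ≡ red z → red y ≡ red z → T (small x) × T (small y)
  monochromatic-small x y z sol rx ry with red z in rz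
  ... | true  = ≤⇒≤ᵇ (red-bounds-summand z (subst (a * elt x ≤_) sol (m≤m+n (a * elt x) (a * elt y))) red-z)
              , ≤⇒≤ᵇ (red-bounds-summand z (subst (a * elt y ≤_) sol (m≤n+m (a * elt y) (a * elt x))) red-z)
    where
    red-z : T (red z)
    red-z = subst T (sym rz) _
  ... | false = ⊥-elim (blue-summands-impossible x y z sol (subst T rx) (subst T ry))

  same-colour : ∀ x y → T (lookup χ x == lookup χ y) → red x ≡ red y
  same-colour x y eq = trans (sym (lookup∘tabulate red x)) (trans (toWitness eq) (lookup∘tabulate red y))

  solution : Fin n → Fin n → Fin n → Bool
  solution x y z = a * elt x + a * elt y ≡ᵇ elt z

  count-monoSol≤ : ∀ x y z →
                   count (monoSol a χ x y z) ≤ count (small x) * (count (small y) * count (solution x y z))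
  count-monoSol≤ x y z = begin
    count (monoSol a χ x y z)                                    ≤⟨ count-mono monochromatic⇒small ⟩
    count (small x ∧ small y ∧ solution x y z)                   ≡⟨ count-∧ (small x) _ ⟩
    count (small x) * count (small y ∧ solution x y z)           ≡⟨ cong (count (small x) *_) (count-∧ (small y) _) ⟩
    count (small x) * (count (small y) * count (solution x y z)) ∎
    where
    monochromatic⇒small : T (monoSol a χ x y z) → T (small x ∧ small y ∧ solution x y z)
    monochromatic⇒small mono =
      let sol , colours = Equivalence.to T-∧ mono
          xy , yz       = Equivalence.to T-∧ colours
          sx , sy       = monochromatic-small x y z (≡ᵇ⇒≡ _ _ sol)
                            (trans (same-colour x y xy) (same-colour y z yz)) (same-colour y z yz)
      in Equivalence.from T-∧ (sx , Equivalence.from T-∧ (sy , sol))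

  #small : ℕ
  #small = sum (map (count ∘ small) (allFin n))

  #small≤s : #small ≤ s
  #small≤s = subst (_≤ s) (sym (sum-allFin (count ∘ small))) (sum-count-elt-≤ᵇ≤ n s)

  solutions-per-pair : ∀ x y →
                       sum (map (λ z → count (monoSol a χ x y z)) (allFin n)) ≤ count (small x) * count (small y)
  solutions-per-pair x y = begin
    sum (map (λ z → count (monoSol a χ x y z)) (allFin n))          ≤⟨ sum-map-mono (allFin n) (count-monoSol≤ x y) ⟩
    sum (map (λ z → cx * (cy * count (solution x y z))) (allFin n)) ≡⟨ sum-map-*ˡ cx _ (allFin n) ⟩
    cx * sum (map (λ z → cy * count (solution x y z)) (allFin n))   ≡⟨ cong (cx *_) (sum-map-*ˡ cy _ (allFin n)) ⟩
    cx * (cy * sum (map (count ∘ solution x y) (allFin n)))          ≤⟨ *-monoʳ-≤ cx (*-monoʳ-≤ cy unique-z) ⟩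
    cx * (cy * 1)                                                    ≡⟨ cong (cx *_) (*-identityʳ cy) ⟩
    cx * cy                                                          ∎
    where
    cx = count (small x)
    cy = count (small y)
    unique-z : sum (map (count ∘ solution x y) (allFin n)) ≤ 1
    unique-z = subst (_≤ 1) (sym (sum-allFin (count ∘ solution x y)))
                     (sum-count-≡ᵇ-elt≤1 n (a * elt x + a * elt y))

  solutions-from : ∀ x → sum (map (λ y → sum (map (λ z → count (monoSol a χ x y z)) (allFin n))) (allFin n))
                         ≤ #small * count (small x)
  solutions-from x = begin
    sum (map (λ y → sum (map (λ z → count (monoSol a χ x y z)) (allFin n))) (allFin n))
      ≤⟨ sum-map-mono (allFin n) (solutions-per-pair x) ⟩
    sum (map (λ y → count (small x) * count (small y)) (allFin n))
      ≡⟨ sum-map-*ˡ (count (small x)) (count ∘ small) (allFin n) ⟩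
    count (small x) * #small
      ≡⟨ *-comm (count (small x)) #small ⟩
    #small * count (small x)
      ∎

  μ≤s² : μ a n χ ≤ s * s
  μ≤s² = begin
    μ a n χ                                               ≤⟨ sum-map-mono (allFin n) solutions-from ⟩
    sum (map (λ x → #small * count (small x)) (allFin n)) ≡⟨ sum-map-*ˡ #small (count ∘ small) (allFin n) ⟩
    #small * #small                                       ≤⟨ *-mono-≤ #small≤s #small≤s ⟩
    s * s                                                 ∎

quotient²≤bound : ∀ k n → let d = 2 * suc k * suc k in (n / d) * (n / d) ≤ bound (suc k) n
quotient²≤bound k n = m*n≤o⇒m≤o/n (s * s) (2 * a ^ 4) (begin
  s * s * (2 * a ^ 4)                         ≤⟨ m≤m+n (s * s * (2 * a ^ 4)) _ ⟩
  s * s * (2 * a ^ 4) + s * s * (2 * a ^ 4)   ≡⟨ square a s ⟨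
  (s * d) * (s * d)                           ≤⟨ *-mono-≤ sd≤n sd≤n ⟩
  n * n                                       ≤⟨ m≤m+n (n * n) (a * a * n) ⟩
  n * n + a * a * n                           ∎)
  where
  a = suc k
  d = 2 * a * a
  s = n / d
  sd≤n : s * d ≤ n
  sd≤n = m/n*n≤m n d
  -- a ^ 4 written out, since the ring solver does not read _^_.
  square : ∀ a s → (s * (2 * a * a)) * (s * (2 * a * a))
                 ≡ s * s * (2 * (a * (a * (a * (a * 1))))) + s * s * (2 * (a * (a * (a * (a * 1)))))
  square = solve-∀

theorem1 : ((a : ℕ) → 0 < a → (n : ℕ) → 0 < n → M a n ≤ bound a n)
           × (∃[ a ] ∃[ n ] (0 < a × 0 < n × M a n < bound a n))
theorem1 = upper-bound , (1 , 1 , s≤s z≤n , s≤s z≤n , s≤s z≤n)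
  where
  upper-bound : (a : ℕ) → 0 < a → (n : ℕ) → 0 < n → M a n ≤ bound a n
  upper-bound (suc k) _ n _ = begin
    M (suc k) n       ≤⟨ M≤μ (suc k) n χ ⟩
    μ (suc k) n χ     ≤⟨ μ≤s² ⟩
    s * s             ≤⟨ quotient²≤bound k n ⟩
    bound (suc k) n   ∎
    where open SplitColoring k n
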